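{- Backwards proof search in each of the calculi $\mathbf{G3}^{Hist}_{\mathsf N}$, $\mathbf{G3}^{Hist}_{\mathsf{NeF}}$, $\mathbf{G3}^{Hist}_{\mathsf{CoPC}}$, $\mathbf{G3}^{Hist}_{\mathsf{MPC}}$ is terminating: there is no infinite sequence of history sequents $S_0,S_1,S_2,\dots$ such that for every $i$, $S_{i+1}$ is a premise of an instance of a rule of the calculus whose conclusion is $S_i$.
   Context: Formulas are built from a countable set of propositional variables and the constant $\top$ (no $\bot$) using $\land,\lor,\to,\neg$. A history sequent is $\mathcal H\mid\Gamma\Rightarrow\varphi$, where $\mathcal H$ is a finite set of formulas, $\Gamma$ a finite multiset of formulas and $\varphi$ a formula (the goal); $(\psi,\mathcal H)$ denotes $\mathcal H$ with $\psi$ added; "$\alpha\in\Gamma$" means $\alpha$ occurs in $\Gamma$. Rules (premises / conclusion, side conditions): (ax) $\mathcal H\mid\Gamma,p\Rightarrow p$ ($p$ a propositional variable); ($\top$) $\mathcal H\mid\Gamma\Rightarrow\top$; ($\to$r$_1$) $\emptyset\mid\Gamma,\alpha\Rightarrow\beta$ / $\mathcal H\mid\Gamma\Rightarrow\alpha\to\beta$ if $\alpha\notin\Gamma$; ($\to$r$_2$) $\mathcal H\mid\Gamma\Rightarrow\beta$ / $\mathcal H\mid\Gamma\Rightarrow\alpha\to\beta$ if $\alpha\in\Gamma$; ($\to$l) $(\varphi,\mathcal H)\mid\Gamma,\alpha\to\beta\Rightarrow\alpha$ and $\emptyset\mid\Gamma,\alpha\to\beta,\beta\Rightarrow\varphi$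 / $\mathcal H\mid\Gamma,\alpha\to\beta\Rightarrow\varphi$ if $\varphi\notin\mathcal H$, $\beta\notin\Gamma$; ($\land$r) $\mathcal H\mid\Gamma\Rightarrow\alpha$ and $\mathcal H\mid\Gamma\Rightarrow\beta$ / $\mathcal H\mid\Gamma\Rightarrow\alpha\land\beta$; ($\land$l$_1$) $\emptyset\mid\Gamma,\alpha\land\beta,\alpha\Rightarrow\varphi$ / $\mathcal H\mid\Gamma,\alpha\land\beta\Rightarrow\varphi$ if $\alpha\notin\Gamma$; ($\land$l$_2$) likewise with $\beta$, if $\beta\notin\Gamma$; ($\lor$r$_i$) $\mathcal H\mid\Gamma\Rightarrow\alpha$ (resp. $\beta$) / $\mathcal H\mid\Gamma\Rightarrow\alpha\lor\beta$; ($\lor$l) $\emptyset\mid\Gamma,\alpha\lor\beta,\alpha\Rightarrow\varphi$ and $\emptyset\mid\Gamma,\alpha\lor\beta,\beta\Rightarrow\varphi$ / $\mathcal H\mid\Gamma,\alpha\lor\beta\Rightarrow\varphi$ if $\alpha,\beta\notin\Gamma$; in ($\to$l), ($\land$l$_i$), ($\lor$l) the goal $\varphi$ must be an atom, a negation or a disjunction. Negation rules, all with conclusion $\mathcal H\mid\Gamma,\neg\alpha\Rightarrow\neg\beta$ except (an): (n$_1$) premises $\emptyset\mid\Gamma,\neg\alpha,\beta\Rightarrow\alpha$ and $\emptyset\mid\Gamma,\neg\alpha,\alpha\Rightarrow\beta$, if $\beta\notin\Gamma\cup\{\neg\alpha\}$, $\alpha\notin\Gamma$; (n$_2$) premises $\emptyset\mid\Gamma,\neg\alpha,\beta\Rightarrow\alpha$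 and $\mathcal H\mid\Gamma,\neg\alpha\Rightarrow\beta$, if $\beta\notin\Gamma\cup\{\neg\alpha\}$, $\alpha\in\Gamma$; (n$_3$) premises $(\neg\beta,\mathcal H)\mid\Gamma,\neg\alpha\Rightarrow\alpha$ and $\emptyset\mid\Gamma,\neg\alpha,\alpha\Rightarrow\beta$, if $\neg\beta\notin\mathcal H$, $\beta\in\Gamma\cup\{\neg\alpha\}$, $\alpha\notin\Gamma$; (n$_4$) premises $(\neg\beta,\mathcal H)\mid\Gamma,\neg\alpha\Rightarrow\alpha$ and $\mathcal H\mid\Gamma,\neg\alpha\Rightarrow\beta$, if $\neg\beta\notin\mathcal H$, $\beta\in\Gamma\cup\{\neg\alpha\}$, $\alpha\in\Gamma$; (nef) premise $(\neg\beta,\mathcal H)\mid\Gamma,\neg\alpha\Rightarrow\alpha$, if $\neg\beta\notin\mathcal H$; (copc$_1$) premise $\emptyset\mid\Gamma,\neg\alpha,\beta\Rightarrow\alpha$, if $\beta\notin\Gamma\cup\{\neg\alpha\}$; (copc$_2$) premise $(\neg\beta,\mathcal H)\mid\Gamma,\neg\alpha\Rightarrow\alpha$, if $\neg\beta\notin\mathcal H$, $\beta\in\Gamma\cup\{\neg\alpha\}$; (an) $\emptyset\mid\Gamma,\alpha\Rightarrow\neg\alpha$ / $\mathcal H\mid\Gamma\Rightarrow\neg\alpha$ if $\alpha\notin\Gamma$. The calculi consist of the positive rules plus: $\mathbf{G3}^{Hist}_{\mathsf N}$: (n$_1$)–(n$_4$); $\mathbf{G3}^{Hist}_{\mathsf{NeF}}$: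 (n$_1$)–(n$_4$), (nef); $\mathbf{G3}^{Hist}_{\mathsf{CoPC}}$: (copc$_1$), (copc$_2$); $\mathbf{G3}^{Hist}_{\mathsf{MPC}}$: (copc$_1$), (copc$_2$), (an). -}

module Defs where

open import Data.Nat using (ℕ; suc)
open import Data.List using (List; []; _∷_)
open import Data.List.Membership.Propositional using (_∈_; _∉_)
open import Data.List.Relation.Binary.Permutation.Propositional using (_↭_)
open import Data.List.Relation.Unary.Any using (Any)
open import Data.Product using (Σ; _×_; ∃)
open import Relation.Binary.PropositionalEquality using (_≡_)
open import Relation.Nullary using (¬_)

infixr 30 _∧′_
infixr 25 _∨′_
infixr 20 _⇒_

data Fm : Set where
  var  : ℕ → Fm
  ⊤′   : Fm
  _∧′_ : Fm → Fm → Fm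
  _∨′_ : Fm → Fm → Fm
  _⇒_  : Fm → Fm → Fm
  ¬′_  : Fm → Fm

data GoalOK : Fm → Set where
  atom : ∀ p → GoalOK (var p)
  neg  : ∀ a → GoalOK (¬′ a)
  disj : ∀ a b → GoalOK (a ∨′ b)

-- History sequents  H ∣ Γ ⇒ φ
-- H (finite set) is represented by a list, Γ (finite multiset) by a list;
-- sequents are identified up to set-equality of H and permutation of Γ
-- (relation _≈ₛ_ below).

infix 4 _∣_⊢_

record Seq : Set where
  constructor _∣_⊢_
  field
    hist : List Fm
    ante : List Fm
    goal : Fm
open Seq public

_≋_ : List Fm → List Fm → Set
H ≋ H′ = ∀ x → (x ∈ H → x ∈ H′) × (x ∈ H′ → x ∈ H)

_≈ₛ_ : Seq → Seq → Set
S ≈ₛ S′ = (hist S ≋ hist S′) × (ante S ↭ ante S′) × (goal S ≡ goal S′)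

data Calc : Set where
  cN cNeF cCoPC cMPC : Calc

data HasN : Calc → Set where
  inN   : HasN cN
  inNeF : HasN cNeF

data HasNeF : Calc → Set where
  inNeF : HasNeF cNeF

data HasCoPC : Calc → Set where
  inCoPC : HasCoPC cCoPC
  inMPC  : HasCoPC cMPC

data HasAN : Calc → Set where
  inMPC : HasAN cMPC

-- In a conclusion  H ∣ Γ , χ ⇒ φ  with principal formula χ we write
-- Δ = Γ , χ  for the whole antecedent (χ ∈ Δ).  The side conditions
-- "ψ ∉ Γ" become "ψ ∉ Δ" because in every case ψ ≠ χ syntactically
-- (e.g. β ≠ α → β, α ≠ ¬α), and "β ∉ Γ ∪ {¬α}" is exactly "β ∉ Δ".
-- Premise antecedents "Γ , χ , ψ" are written ψ ∷ Δ.

data Inst (c : Calc) : List Seq → Seq → Set where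
  ax   : ∀ H Δ p → var p ∈ Δ → Inst c [] (H ∣ Δ ⊢ var p)
  top  : ∀ H Δ → Inst c [] (H ∣ Δ ⊢ ⊤′)
  →r₁  : ∀ H Δ a b → a ∉ Δ →
         Inst c (([] ∣ a ∷ Δ ⊢ b) ∷ []) (H ∣ Δ ⊢ (a ⇒ b))
  →r₂  : ∀ H Δ a b → a ∈ Δ →
         Inst c ((H ∣ Δ ⊢ b) ∷ []) (H ∣ Δ ⊢ (a ⇒ b))
  →l   : ∀ H Δ a b φ → (a ⇒ b) ∈ Δ → GoalOK φ → φ ∉ H → b ∉ Δ →
         Inst c ((φ ∷ H ∣ Δ ⊢ a) ∷ ([] ∣ b ∷ Δ ⊢ φ) ∷ []) (H ∣ Δ ⊢ φ)
  ∧r   : ∀ H Δ a b →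
         Inst c ((H ∣ Δ ⊢ a) ∷ (H ∣ Δ ⊢ b) ∷ []) (H ∣ Δ ⊢ (a ∧′ b))
  ∧l₁  : ∀ H Δ a b φ → (a ∧′ b) ∈ Δ → GoalOK φ → a ∉ Δ →
         Inst c (([] ∣ a ∷ Δ ⊢ φ) ∷ []) (H ∣ Δ ⊢ φ)
  ∧l₂  : ∀ H Δ a b φ → (a ∧′ b) ∈ Δ → GoalOK φ → b ∉ Δ →
         Inst c (([] ∣ b ∷ Δ ⊢ φ) ∷ []) (H ∣ Δ ⊢ φ)
  ∨r₁  : ∀ H Δ a b → Inst c ((H ∣ Δ ⊢ a) ∷ []) (H ∣ Δ ⊢ (a ∨′ b))
  ∨r₂  : ∀ H Δ a b → Inst c ((H ∣ Δ ⊢ b) ∷ []) (H ∣ Δ ⊢ (a ∨′ b))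
  ∨l   : ∀ H Δ a b φ → (a ∨′ b) ∈ Δ → GoalOK φ → a ∉ Δ → b ∉ Δ →
         Inst c (([] ∣ a ∷ Δ ⊢ φ) ∷ ([] ∣ b ∷ Δ ⊢ φ) ∷ []) (H ∣ Δ ⊢ φ)
  n₁   : HasN c → ∀ H Δ a b → (¬′ a) ∈ Δ → b ∉ Δ → a ∉ Δ →
         Inst c (([] ∣ b ∷ Δ ⊢ a) ∷ ([] ∣ a ∷ Δ ⊢ b) ∷ []) (H ∣ Δ ⊢ (¬′ b))
  n₂   : HasN c → ∀ H Δ a b → (¬′ a) ∈ Δ → b ∉ Δ → a ∈ Δ →
         Inst c (([] ∣ b ∷ Δ ⊢ a) ∷ (H ∣ Δ ⊢ b) ∷ []) (H ∣ Δ ⊢ (¬′ b))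
  n₃   : HasN c → ∀ H Δ a b → (¬′ a) ∈ Δ → (¬′ b) ∉ H → b ∈ Δ → a ∉ Δ →
         Inst c (((¬′ b) ∷ H ∣ Δ ⊢ a) ∷ ([] ∣ a ∷ Δ ⊢ b) ∷ []) (H ∣ Δ ⊢ (¬′ b))
  n₄   : HasN c → ∀ H Δ a b → (¬′ a) ∈ Δ → (¬′ b) ∉ H → b ∈ Δ → a ∈ Δ →
         Inst c (((¬′ b) ∷ H ∣ Δ ⊢ a) ∷ (H ∣ Δ ⊢ b) ∷ []) (H ∣ Δ ⊢ (¬′ b))
  nef  : HasNeF c → ∀ H Δ a b → (¬′ a) ∈ Δ → (¬′ b) ∉ H →
         Inst c (((¬′ b) ∷ H ∣ Δ ⊢ a) ∷ []) (H ∣ Δ ⊢ (¬′ b))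
  copc₁ : HasCoPC c → ∀ H Δ a b → (¬′ a) ∈ Δ → b ∉ Δ →
         Inst c (([] ∣ b ∷ Δ ⊢ a) ∷ []) (H ∣ Δ ⊢ (¬′ b))
  copc₂ : HasCoPC c → ∀ H Δ a b → (¬′ a) ∈ Δ → (¬′ b) ∉ H → b ∈ Δ →
         Inst c (((¬′ b) ∷ H ∣ Δ ⊢ a) ∷ []) (H ∣ Δ ⊢ (¬′ b))
  an   : HasAN c → ∀ H Δ a → a ∉ Δ →
         Inst c (([] ∣ a ∷ Δ ⊢ (¬′ a)) ∷ []) (H ∣ Δ ⊢ (¬′ a))

Step : Calc → Seq → Seq → Set
Step c S S′ = Σ (List Seq) λ ps → Σ Seq λ T →
  (T ≈ₛ S) × Inst c ps T × Any (S′ ≈ₛ_) ps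

module Submission where

-- Fix a subformula-closed finite list U containing every formula of the
-- root sequent.  Every rule only introduces (immediate) subformulas of
-- formulas already present, so all sequents of a branch stay inside U.
-- Such a sequent H ∣ Δ ⊢ φ is measured by the triple
--   (formulas of U missing from Δ, formulas of U missing from H, size φ),
-- ordered lexicographically.  Each premise of each rule is strictly
-- smaller than the conclusion: it either adds a new formula to the
-- antecedent (the history may be reset), or keeps the antecedent and adds
-- a new formula to the history, or keeps both and replaces the goal by an
-- immediate subformula.  The measure is invariant under the identification
-- of sequents up to sets/multisets, and the lexicographic order on ℕ³ is
-- well founded, so no infinite backwards search branch exists.

open import Defs
open import Data.Nat using (ℕ; zero; suc; _+_; _<_; _≤_; z≤n; s≤s)
import Data.Nat as ℕ
open import Data.Nat.Properties using (≤-refl; ≤-antisym; m≤n⇒m≤1+n; m≤m+n; m≤n+m)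
open import Data.Nat.Induction using (<-wellFounded)
open import Data.Product using (_×_; _,_; proj₁; proj₂)
open import Data.Product.Relation.Binary.Lex.Strict using (×-Lex; ×-wellFounded)
open import Data.Sum using (inj₁; inj₂)
open import Data.Empty using (⊥-elim)
open import Data.List using (List; []; _∷_; _++_; concatMap)
open import Data.List.Membership.Propositional using (_∈_; _∉_; find)
open import Data.List.Membership.Propositional.Properties
  using (∈-++⁺ˡ; ∈-++⁺ʳ; ∈-++⁻; ∈-concatMap⁺; ∈-concatMap⁻)
open import Data.List.Relation.Binary.Subset.Propositional using (_⊆_)
open import Data.List.Relation.Binary.Permutation.Propositional using (↭-sym)
open import Data.List.Relation.Binary.Permutation.Propositional.Properties using (∈-resp-↭)
open import Data.List.Relation.Unary.Any using (here; there)
import Data.List.Relation.Unary.Any as Any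
open import Induction.WellFounded using (WellFounded; Acc; acc)
open import Relation.Binary.Definitions using (DecidableEquality)
open import Relation.Binary.PropositionalEquality using (_≡_; refl; sym; cong; cong₂; subst₂)
open import Relation.Nullary using (¬_; yes; no)
open import Relation.Nullary.Decidable using (map′; _×-dec_)

infix 4 _≟_
_≟_ : DecidableEquality Fm
var p ≟ var q = map′ (cong var) (λ { refl → refl }) (p ℕ.≟ q)
⊤′ ≟ ⊤′ = yes refl
(a ∧′ b) ≟ (c ∧′ d) = map′ (λ { (refl , refl) → refl }) (λ { refl → refl , refl }) (a ≟ c ×-dec b ≟ d)
(a ∨′ b) ≟ (c ∨′ d) = map′ (λ { (refl , refl) → refl }) (λ { refl → refl , refl }) (a ≟ c ×-dec b ≟ d)
(a ⇒ b) ≟ (c ⇒ d) = map′ (λ { (refl , refl) → refl }) (λ { refl → refl , refl }) (a ≟ c ×-dec b ≟ d)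
(¬′ a) ≟ (¬′ c) = map′ (cong ¬′_) (λ { refl → refl }) (a ≟ c)
var _ ≟ ⊤′ = no λ ()
var _ ≟ (_ ∧′ _) = no λ ()
var _ ≟ (_ ∨′ _) = no λ ()
var _ ≟ (_ ⇒ _) = no λ ()
var _ ≟ (¬′ _) = no λ ()
⊤′ ≟ var _ = no λ ()
⊤′ ≟ (_ ∧′ _) = no λ ()
⊤′ ≟ (_ ∨′ _) = no λ ()
⊤′ ≟ (_ ⇒ _) = no λ ()
⊤′ ≟ (¬′ _) = no λ ()
(_ ∧′ _) ≟ var _ = no λ ()
(_ ∧′ _) ≟ ⊤′ = no λ ()
(_ ∧′ _) ≟ (_ ∨′ _) = no λ ()
(_ ∧′ _) ≟ (_ ⇒ _) = no λ ()
(_ ∧′ _) ≟ (¬′ _) = no λ ()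
(_ ∨′ _) ≟ var _ = no λ ()
(_ ∨′ _) ≟ ⊤′ = no λ ()
(_ ∨′ _) ≟ (_ ∧′ _) = no λ ()
(_ ∨′ _) ≟ (_ ⇒ _) = no λ ()
(_ ∨′ _) ≟ (¬′ _) = no λ ()
(_ ⇒ _) ≟ var _ = no λ ()
(_ ⇒ _) ≟ ⊤′ = no λ ()
(_ ⇒ _) ≟ (_ ∧′ _) = no λ ()
(_ ⇒ _) ≟ (_ ∨′ _) = no λ ()
(_ ⇒ _) ≟ (¬′ _) = no λ ()
(¬′ _) ≟ var _ = no λ ()
(¬′ _) ≟ ⊤′ = no λ ()
(¬′ _) ≟ (_ ∧′ _) = no λ ()
(¬′ _) ≟ (_ ∨′ _) = no λ ()
(¬′ _) ≟ (_ ⇒ _) = no λ ()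

open import Data.List.Membership.DecPropositional _≟_ using (_∈?_)

infix 4 _≺_
data _≺_ : Fm → Fm → Set where
  ∧ˡ : ∀ {a b} → a ≺ a ∧′ b
  ∧ʳ : ∀ {a b} → b ≺ a ∧′ b
  ∨ˡ : ∀ {a b} → a ≺ a ∨′ b
  ∨ʳ : ∀ {a b} → b ≺ a ∨′ b
  ⇒ˡ : ∀ {a b} → a ≺ a ⇒ b
  ⇒ʳ : ∀ {a b} → b ≺ a ⇒ b
  ¬· : ∀ {a} → a ≺ ¬′ a

size : Fm → ℕ
size (var _) = 0
size ⊤′ = 0
size (a ∧′ b) = suc (size a + size b)
size (a ∨′ b) = suc (size a + size b)
size (a ⇒ b) = suc (size a + size b)
size (¬′ a) = suc (size a)

≺-size : ∀ {x y} → y ≺ x → size y < size x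
≺-size (∧ˡ {a} {b}) = s≤s (m≤m+n (size a) (size b))
≺-size (∧ʳ {a} {b}) = s≤s (m≤n+m (size b) (size a))
≺-size (∨ˡ {a} {b}) = s≤s (m≤m+n (size a) (size b))
≺-size (∨ʳ {a} {b}) = s≤s (m≤n+m (size b) (size a))
≺-size (⇒ˡ {a} {b}) = s≤s (m≤m+n (size a) (size b))
≺-size (⇒ʳ {a} {b}) = s≤s (m≤n+m (size b) (size a))
≺-size ¬· = ≤-refl

SubformulaClosed : List Fm → Set
SubformulaClosed U = ∀ {x y} → y ≺ x → x ∈ U → y ∈ U

sub : Fm → List Fm
sub (var p) = var p ∷ []
sub ⊤′ = ⊤′ ∷ []
sub (a ∧′ b) = (a ∧′ b) ∷ sub a ++ sub b
sub (a ∨′ b) = (a ∨′ b) ∷ sub a ++ sub b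
sub (a ⇒ b) = (a ⇒ b) ∷ sub a ++ sub b
sub (¬′ a) = (¬′ a) ∷ sub a

sub-refl : ∀ φ → φ ∈ sub φ
sub-refl (var _) = here refl
sub-refl ⊤′ = here refl
sub-refl (_ ∧′ _) = here refl
sub-refl (_ ∨′ _) = here refl
sub-refl (_ ⇒ _) = here refl
sub-refl (¬′ _) = here refl

≺-sub : ∀ {x y} → y ≺ x → y ∈ sub x
≺-sub (∧ˡ {a}) = there (∈-++⁺ˡ (sub-refl a))
≺-sub (∧ʳ {a} {b}) = there (∈-++⁺ʳ (sub a) (sub-refl b))
≺-sub (∨ˡ {a}) = there (∈-++⁺ˡ (sub-refl a))
≺-sub (∨ʳ {a} {b}) = there (∈-++⁺ʳ (sub a) (sub-refl b))
≺-sub (⇒ˡ {a}) = there (∈-++⁺ˡ (sub-refl a))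
≺-sub (⇒ʳ {a} {b}) = there (∈-++⁺ʳ (sub a) (sub-refl b))
≺-sub (¬· {a}) = there (sub-refl a)

sub-closed : ∀ φ → SubformulaClosed (sub φ)
sub-closed-++ : ∀ a b → SubformulaClosed (sub a ++ sub b)

sub-closed (var _) () (here refl)
sub-closed ⊤′ () (here refl)
sub-closed (_ ∧′ _) y≺x (here refl) = ≺-sub y≺x
sub-closed (a ∧′ b) y≺x (there x∈) = there (sub-closed-++ a b y≺x x∈)
sub-closed (_ ∨′ _) y≺x (here refl) = ≺-sub y≺x
sub-closed (a ∨′ b) y≺x (there x∈) = there (sub-closed-++ a b y≺x x∈)
sub-closed (_ ⇒ _) y≺x (here refl) = ≺-sub y≺x
sub-closed (a ⇒ b) y≺x (there x∈) = there (sub-closed-++ a b y≺x x∈)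
sub-closed (¬′ _) y≺x (here refl) = ≺-sub y≺x
sub-closed (¬′ a) y≺x (there x∈) = there (sub-closed a y≺x x∈)

sub-closed-++ a b y≺x x∈ with ∈-++⁻ (sub a) x∈
... | inj₁ x∈a = ∈-++⁺ˡ (sub-closed a y≺x x∈a)
... | inj₂ x∈b = ∈-++⁺ʳ (sub a) (sub-closed b y≺x x∈b)

closure : List Fm → List Fm
closure = concatMap sub

closure-⊇ : ∀ R → R ⊆ closure R
closure-⊇ R φ∈R = ∈-concatMap⁺ sub (Any.map (λ { refl → sub-refl _ }) φ∈R)

closure-closed : ∀ R → SubformulaClosed (closure R)
closure-closed R y≺x x∈ = ∈-concatMap⁺ sub (Any.map (sub-closed _ y≺x) (∈-concatMap⁻ sub {xs = R} x∈))

missing : List Fm → List Fm → ℕ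
missing A [] = 0
missing A (x ∷ U) with x ∈? A
... | yes _ = missing A U
... | no _ = suc (missing A U)

missing-antitone : ∀ {A B} U → A ⊆ B → missing B U ≤ missing A U
missing-antitone [] A⊆B = z≤n
missing-antitone {A} {B} (x ∷ U) A⊆B with x ∈? A | x ∈? B
... | yes _ | yes _ = missing-antitone U A⊆B
... | yes x∈A | no x∉B = ⊥-elim (x∉B (A⊆B x∈A))
... | no _ | yes _ = m≤n⇒m≤1+n (missing-antitone U A⊆B)
... | no _ | no _ = s≤s (missing-antitone U A⊆B)

missing-decreases : ∀ {A B x} U → A ⊆ B → x ∈ U → x ∈ B → x ∉ A →
                    missing B U < missing A U
missing-decreases {A} {B} (y ∷ U) A⊆B (here refl) x∈B x∉A with y ∈? A | y ∈? B
... | yes y∈A | _ = ⊥-elim (x∉A y∈A)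
... | no _ | no y∉B = ⊥-elim (y∉B x∈B)
... | no _ | yes _ = s≤s (missing-antitone U A⊆B)
missing-decreases {A} {B} (y ∷ U) A⊆B (there x∈U) x∈B x∉A with y ∈? A | y ∈? B
... | yes _ | yes _ = missing-decreases U A⊆B x∈U x∈B x∉A
... | yes y∈A | no y∉B = ⊥-elim (y∉B (A⊆B y∈A))
... | no _ | yes _ = m≤n⇒m≤1+n (missing-decreases U A⊆B x∈U x∈B x∉A)
... | no _ | no _ = s≤s (missing-decreases U A⊆B x∈U x∈B x∉A)

missing-cong : ∀ {A B} U → A ⊆ B → B ⊆ A → missing A U ≡ missing B U
missing-cong U A⊆B B⊆A = ≤-antisym (missing-antitone U B⊆A) (missing-antitone U A⊆B)

no-infinite-descent : ∀ {A : Set} {_⊏_ : A → A → Set} → WellFounded _⊏_ →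
                      (f : ℕ → A) → ¬ (∀ i → f (suc i) ⊏ f i)
no-infinite-descent {A} {_⊏_} wf f descends = go f (wf (f 0)) descends
  where
  go : (g : ℕ → A) → Acc _⊏_ (g 0) → ¬ (∀ i → g (suc i) ⊏ g i)
  go g (acc below) d = go (λ i → g (suc i)) (below (d 0)) (λ i → d (suc i))

Measure : Set
Measure = ℕ × ℕ × ℕ

infix 4 _⊏_
_⊏_ : Measure → Measure → Set
_⊏_ = ×-Lex _≡_ _<_ (×-Lex _≡_ _<_ _<_)

⊏-wellFounded : WellFounded _⊏_
⊏-wellFounded = ×-wellFounded <-wellFounded (×-wellFounded <-wellFounded <-wellFounded)

module Descent (U : List Fm) (closed : SubformulaClosed U) where

  μ : Seq → Measure
  μ S = missing (ante S) U , missing (hist S) U , size (goal S)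

  -- Antecedent and goal lie in U (the history needs no bound: only
  -- formulas of U are counted).
  Within : Seq → Set
  Within S = (ante S ⊆ U) × goal S ∈ U

  Descends : Seq → Seq → Set
  Descends P T = Within P × μ P ⊏ μ T

  grow-antecedent : ∀ {H Δ φ ψ g H′} → Within (H ∣ Δ ⊢ φ) → ψ ∈ U → ψ ∉ Δ → g ∈ U →
                    Descends (H′ ∣ ψ ∷ Δ ⊢ g) (H ∣ Δ ⊢ φ)
  grow-antecedent (Δ⊆U , _) ψ∈U ψ∉Δ g∈U =
    ((λ { (here refl) → ψ∈U ; (there x∈Δ) → Δ⊆U x∈Δ }) , g∈U) ,
    inj₁ (missing-decreases U there ψ∈U (here refl) ψ∉Δ)

  grow-history : ∀ {H Δ φ ψ g} → Within (H ∣ Δ ⊢ φ) → ψ ∈ U → ψ ∉ H → g ∈ U →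
                 Descends (ψ ∷ H ∣ Δ ⊢ g) (H ∣ Δ ⊢ φ)
  grow-history (Δ⊆U , _) ψ∈U ψ∉H g∈U =
    (Δ⊆U , g∈U) , inj₂ (refl , inj₁ (missing-decreases U there ψ∈U (here refl) ψ∉H))

  shrink-goal : ∀ {H Δ φ g} → Within (H ∣ Δ ⊢ φ) → g ≺ φ → Descends (H ∣ Δ ⊢ g) (H ∣ Δ ⊢ φ)
  shrink-goal (Δ⊆U , φ∈U) g≺φ = (Δ⊆U , closed g≺φ φ∈U) , inj₂ (refl , inj₂ (refl , ≺-size g≺φ))

  goal-part : ∀ {Δ φ y} → (Δ ⊆ U) × φ ∈ U → y ≺ φ → y ∈ U
  goal-part (_ , φ∈U) y≺φ = closed y≺φ φ∈U

  ante-part : ∀ {Δ φ χ y} → (Δ ⊆ U) × φ ∈ U → χ ∈ Δ → y ≺ χ → y ∈ U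
  ante-part (Δ⊆U , _) χ∈Δ y≺χ = closed y≺χ (Δ⊆U χ∈Δ)

  -- In each case the new formula is an immediate subformula of the goal or
  -- of the principal formula, or (history extensions) the goal itself.
  premise-descends : ∀ {c ps T P} → Within T → Inst c ps T → P ∈ ps → Descends P T
  premise-descends w (→r₁ _ _ _ _ a∉Δ) (here refl) =
    grow-antecedent w (goal-part w ⇒ˡ) a∉Δ (goal-part w ⇒ʳ)
  premise-descends w (→r₂ _ _ _ _ _) (here refl) = shrink-goal w ⇒ʳ
  premise-descends w (→l _ _ _ _ _ a⇒b∈Δ _ φ∉H _) (here refl) =
    grow-history w (proj₂ w) φ∉H (ante-part w a⇒b∈Δ ⇒ˡ)
  premise-descends w (→l _ _ _ _ _ a⇒b∈Δ _ _ b∉Δ) (there (here refl)) =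
    grow-antecedent w (ante-part w a⇒b∈Δ ⇒ʳ) b∉Δ (proj₂ w)
  premise-descends w (∧r _ _ _ _) (here refl) = shrink-goal w ∧ˡ
  premise-descends w (∧r _ _ _ _) (there (here refl)) = shrink-goal w ∧ʳ
  premise-descends w (∧l₁ _ _ _ _ _ a∧b∈Δ _ a∉Δ) (here refl) =
    grow-antecedent w (ante-part w a∧b∈Δ ∧ˡ) a∉Δ (proj₂ w)
  premise-descends w (∧l₂ _ _ _ _ _ a∧b∈Δ _ b∉Δ) (here refl) =
    grow-antecedent w (ante-part w a∧b∈Δ ∧ʳ) b∉Δ (proj₂ w)
  premise-descends w (∨r₁ _ _ _ _) (here refl) = shrink-goal w ∨ˡ
  premise-descends w (∨r₂ _ _ _ _) (here refl) = shrink-goal w ∨ʳ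
  premise-descends w (∨l _ _ _ _ _ a∨b∈Δ _ a∉Δ _) (here refl) =
    grow-antecedent w (ante-part w a∨b∈Δ ∨ˡ) a∉Δ (proj₂ w)
  premise-descends w (∨l _ _ _ _ _ a∨b∈Δ _ _ b∉Δ) (there (here refl)) =
    grow-antecedent w (ante-part w a∨b∈Δ ∨ʳ) b∉Δ (proj₂ w)
  premise-descends w (n₁ _ _ _ _ _ ¬a∈Δ b∉Δ _) (here refl) =
    grow-antecedent w (goal-part w ¬·) b∉Δ (ante-part w ¬a∈Δ ¬·)
  premise-descends w (n₁ _ _ _ _ _ ¬a∈Δ _ a∉Δ) (there (here refl)) =
    grow-antecedent w (ante-part w ¬a∈Δ ¬·) a∉Δ (goal-part w ¬·)
  premise-descends w (n₂ _ _ _ _ _ ¬a∈Δ b∉Δ _) (here refl) =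
    grow-antecedent w (goal-part w ¬·) b∉Δ (ante-part w ¬a∈Δ ¬·)
  premise-descends w (n₂ _ _ _ _ _ _ _ _) (there (here refl)) = shrink-goal w ¬·
  premise-descends w (n₃ _ _ _ _ _ ¬a∈Δ ¬b∉H _ _) (here refl) =
    grow-history w (proj₂ w) ¬b∉H (ante-part w ¬a∈Δ ¬·)
  premise-descends w (n₃ _ _ _ _ _ ¬a∈Δ _ _ a∉Δ) (there (here refl)) =
    grow-antecedent w (ante-part w ¬a∈Δ ¬·) a∉Δ (goal-part w ¬·)
  premise-descends w (n₄ _ _ _ _ _ ¬a∈Δ ¬b∉H _ _) (here refl) =
    grow-history w (proj₂ w) ¬b∉H (ante-part w ¬a∈Δ ¬·)
  premise-descends w (n₄ _ _ _ _ _ _ _ _ _) (there (here refl)) = shrink-goal w ¬·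
  premise-descends w (nef _ _ _ _ _ ¬a∈Δ ¬b∉H) (here refl) =
    grow-history w (proj₂ w) ¬b∉H (ante-part w ¬a∈Δ ¬·)
  premise-descends w (copc₁ _ _ _ _ _ ¬a∈Δ b∉Δ) (here refl) =
    grow-antecedent w (goal-part w ¬·) b∉Δ (ante-part w ¬a∈Δ ¬·)
  premise-descends w (copc₂ _ _ _ _ _ ¬a∈Δ ¬b∉H _) (here refl) =
    grow-history w (proj₂ w) ¬b∉H (ante-part w ¬a∈Δ ¬·)
  premise-descends w (an _ _ _ _ a∉Δ) (here refl) = grow-antecedent w (goal-part w ¬·) a∉Δ (proj₂ w)

  μ-resp : ∀ {S T} → S ≈ₛ T → μ S ≡ μ T
  μ-resp (H≋H′ , Δ↭Δ′ , refl) =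
    cong₂ _,_ (missing-cong U (∈-resp-↭ Δ↭Δ′) (∈-resp-↭ (↭-sym Δ↭Δ′)))
              (cong₂ _,_ (missing-cong U (λ {x} → proj₁ (H≋H′ x)) (λ {x} → proj₂ (H≋H′ x))) refl)

  within-resp : ∀ {S T} → S ≈ₛ T → Within T → Within S
  within-resp (_ , Δ↭Δ′ , refl) (Δ′⊆U , φ∈U) = (λ x∈Δ → Δ′⊆U (∈-resp-↭ Δ↭Δ′ x∈Δ)) , φ∈U

  step-descends : ∀ {c S S′} → Within S → Step c S S′ → Descends S′ S
  step-descends w (ps , T , T≈S , inst , S′≈some) with find S′≈some
  ... | P , P∈ps , S′≈P with premise-descends (within-resp T≈S w) inst P∈ps
  ... | wP , μP⊏μT = within-resp S′≈P wP , subst₂ _⊏_ (sym (μ-resp S′≈P)) (μ-resp T≈S) μP⊏μT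

theorem5p5 : (c : Calc) (S : ℕ → Seq) → ¬ (∀ i → Step c (S i) (S (suc i)))
theorem5p5 c S step = no-infinite-descent ⊏-wellFounded (λ i → μ (S i))
                        (λ i → proj₂ (step-descends (within i) (step i)))
  where
  root : List Fm
  root = goal (S 0) ∷ ante (S 0)

  open Descent (closure root) (closure-closed root)

  within : ∀ i → Within (S i)
  within zero = (λ φ∈Δ → closure-⊇ root (there φ∈Δ)) , closure-⊇ root (here refl)
  within (suc i) = proj₁ (step-descends (within i) (step i))
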